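{- For all integers $1\le i<j\le m$ and every integer $r$, \[\sigma_{(n-1)(j-i)}^{(r)}(\mathbf{x}_i, \dots, \mathbf{x}_j) = \sum_{k = 0}^{n-1}\left ( \prod_{t = 0}^{k-1}x_i^{(r-t)} \right ) \sigma_{(n-1)(j-i-1)}^{(r-k)}(\mathbf{x}_i, \dots, \mathbf{x}_{j-1})\left ( \prod_{s = 0}^{n-k-2}x_j^{(r-k+j-i-1-s)} \right ),\] and \[\bar{\sigma}_{(n-1)(j-i)}^{(r)}(\mathbf{x}_i, \dots, \mathbf{x}_j) = \sum_{k = 0}^{n-1}\left ( \prod_{t = 0}^{k-1}x_i^{(r-t)} \right ) \bar{\sigma}_{(n-1)(j-i-1)}^{(r-k)}(\mathbf{x}_{i+1}, \dots, \mathbf{x}_{j})\left ( \prod_{s = 0}^{n-k-2}x_j^{(r-k+j-i-1-s)} \right ).\]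
   Context: Fix positive integers $n,m$. Let $\mathbf{x}_1,\dots,\mathbf{x}_m$ be vectors of variables (or elements of $\mathbb{R}^n_{>0}$), $\mathbf{x}_i=(x_i^{(1)},\dots,x_i^{(n)})$; upper indices are always read modulo $n$ (so $x_i^{(r)}=x_i^{(r+n)}$ for every integer $r$). Empty products equal $1$. For integers $k\ge 0$ and $r$, define $\tau_k^{(r)}(\mathbf{x}_1,\dots,\mathbf{x}_m)=\sum x_{i_1}^{(r)}x_{i_2}^{(r-1)}\cdots x_{i_k}^{(r-k+1)}$, the sum over all $1\le i_1\le i_2\le\dots\le i_k\le m$ in which no value appears more than $n-1$ times among $i_1,\dots,i_k$; by convention $\tau_0^{(r)}=1$, and $\tau_k^{(r)}=0$ if $k<0$ or $k>m(n-1)$ (in particular, for an empty list of vectors $\tau_0=1$ and $\tau_k=0$ for $k\neq0$). Define $\sigma_k^{(r)}(\mathbf{x}_1,\dots,\mathbf{x}_m)=\sum_{i=0}^k x_1^{(r)}x_1^{(r-1)}\cdots x_1^{(r-i+1)}\,\tau_{k-i}^{(r-i)}(\mathbf{x}_2,\dots,\mathbf{x}_m)$ and $\bar{\sigma}_k^{(r)}(\mathbf{x}_1,\dots,\mathbf{x}_m)=\sum_{i=0}^k \tau_{k-i}^{(r)}(\mathbf{x}_1,\dots,\mathbf{x}_{m-1})\,x_m^{(r-k+i)}x_m^{(r-k+i-1)}\cdots x_m^{(r-k+1)}$ (the last product has $i$ factors). These functions of a consecutive subsequence $\mathbf{x}_i,\dots,\mathbf{x}_j$ are defined by the same formulas after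 relabeling the vectors. -}

module Defs where

open import Level using (Level)
open import Algebra.Bundles using (CommutativeSemiring)
open import Data.Bool using (Bool; true; false; _∧_; if_then_else_)
open import Data.Nat as ℕ using (ℕ; zero; suc; NonZero; _∸_; _≤ᵇ_; _≡ᵇ_)
open import Data.Integer as ℤ using (ℤ; +_; _%ℕ_)
open import Data.Integer.DivMod using (n%ℕd<d)
open import Data.Fin using (Fin; toℕ; fromℕ<)
open import Data.List using (List; []; _∷_; length; lookup; map; upTo; concatMap; filter)
open import Data.Maybe using (Maybe; just; nothing)
open import Data.Product using (_×_; _,_)

-- Everything is stated for an arbitrary commutative semiring R (the identity is a
-- polynomial identity with natural-number coefficients, so this covers both the
-- polynomial ring in the variables x_i^{(r)} and positive reals).

module _ {c ℓ : Level} (R : CommutativeSemiring c ℓ) (n : ℕ) .{{_ : NonZero n}} where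
  open CommutativeSemiring R

  Vecₙ : Set c
  Vecₙ = Fin n → Carrier

  -- component with upper index r, read modulo n
  comp : Vecₙ → ℤ → Carrier
  comp v r = v (fromℕ< (n%ℕd<d r n))

  sumTo : ℕ → (ℕ → Carrier) → Carrier
  sumTo zero    f = f 0
  sumTo (suc N) f = sumTo N f + f (suc N)

  prodBelow : ℕ → (ℕ → Carrier) → Carrier
  prodBelow zero    f = 1#
  prodBelow (suc a) f = prodBelow a f * f a

  sumList : List Carrier → Carrier
  sumList []       = 0#
  sumList (a ∷ as) = a + sumList as

  allSeqs : (L k : ℕ) → List (List (Fin L))
  allSeqs L zero    = [] ∷ []
  allSeqs L (suc k) = concatMap (λ s → map (λ i → i ∷ s) (Data.List.allFin L)) (allSeqs L k)

  nondecreasing : ∀ {L} → List (Fin L) → Bool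
  nondecreasing []           = true
  nondecreasing (i ∷ [])     = true
  nondecreasing (i ∷ j ∷ is) = (toℕ i ≤ᵇ toℕ j) ∧ nondecreasing (j ∷ is)

  count : ∀ {L} → Fin L → List (Fin L) → ℕ
  count v []       = 0
  count v (i ∷ is) = if toℕ v ≡ᵇ toℕ i then suc (count v is) else count v is

  allB : ∀ {a} {A : Set a} → (A → Bool) → List A → Bool
  allB p []       = true
  allB p (a ∷ as) = p a ∧ allB p as

  admissible : ∀ {L} → List (Fin L) → Bool
  admissible s = nondecreasing s ∧ allB (λ v → count v s ≤ᵇ (n ∸ 1)) s

  seqProd : (vs : List Vecₙ) → ℤ → List (Fin (length vs)) → Carrier
  seqProd vs r []       = 1#
  seqProd vs r (i ∷ is) = comp (lookup vs i) r * seqProd vs (r ℤ.- ℤ.1ℤ) is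

  τ : ℕ → ℤ → List Vecₙ → Carrier
  τ k r vs = sumList (map (λ s → if admissible s then seqProd vs r s else 0#)
                          (allSeqs (length vs) k))

  -- σ_k^{(r)}(x_1, ..., x_m); the list must be nonempty (value 0 on [] is never used)
  σ : ℕ → ℤ → List Vecₙ → Carrier
  σ k r []        = 0#
  σ k r (x₁ ∷ xs) =
    sumTo k (λ i → prodBelow i (λ t → comp x₁ (r ℤ.- + t)) * τ (k ∸ i) (r ℤ.- + i) xs)

  splitLast : List Vecₙ → Maybe (List Vecₙ × Vecₙ)
  splitLast []       = nothing
  splitLast (v ∷ vs) with splitLast vs
  ... | nothing        = just ([] , v)
  ... | just (ws , w)  = just (v ∷ ws , w)

  σ̄' : ℕ → ℤ → List Vecₙ → Vecₙ → Carrier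
  σ̄' k r xs xₘ =
    sumTo k (λ i → τ (k ∸ i) r xs * prodBelow i (λ t → comp xₘ (r ℤ.- + k ℤ.+ + i ℤ.- + t)))

  σ̄ : ℕ → ℤ → List Vecₙ → Carrier
  σ̄ k r vs with splitLast vs
  ... | nothing        = 0#
  ... | just (xs , xₘ) = σ̄' k r xs xₘ

segment : ∀ {a} {A : Set a} → (ℕ → A) → ℕ → ℕ → List A
segment x i j = map (λ t → x (i ℕ.+ t)) (upTo (suc (j ∸ i)))

module Submission where

-- Split the sum defining τ(x_1, …, x_m) according to the number b of leading indices equal to 1: an admissible
-- sequence starts with b ≤ n - 1 copies of 1, contributing x_1^(r) ⋯ x_1^(r-b+1), and continues with an admissible
-- sequence for x_2, …, x_m read from the upper index r - b. Hence τ(x_1, …, x_m) = F ⊛ τ(x_2, …, x_m) for the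
-- twisted convolution (F ⊛ G)_k^(r) = Σ_a F_a^(r) G_(k-a)^(r-a), where F is the falling product of x_1 cut off
-- above degree n - 1; σ and σ̄ are the same convolutions with the cut-off removed at the first, resp. last, vector.
-- The convolution is associative, τ of m vectors vanishes above degree m(n - 1), and falling products are
-- multiplicative, so in the top degree (n - 1)(j - i) only the terms in which the outer blocks have complementary
-- lengths k and n - 1 - k survive. The remaining difference from the stated formula is in the upper indices of
-- x_j, which agree modulo n.

open import Defs
open import Algebra.Bundles using (CommutativeSemiring)
open import Data.Bool using (Bool; true; false; _∧_; if_then_else_; T)
import Data.Bool.Properties as Bool
open import Data.Fin using (Fin; zero; suc; toℕ)
import Data.Fin.Properties as Fin
open import Data.Integer as ℤ using (ℤ; +_; -[1+_])
import Data.Integer.Properties as ℤ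
open import Data.Integer.Tactic.RingSolver using (solve-∀)
open import Data.List
  using (List; []; _∷_; _++_; [_]; _∷ʳ_; map; replicate; length; allFin; concatMap; applyUpTo; upTo)
import Data.List.Properties as List
open import Data.Maybe using (just)
open import Data.Nat as ℕ using (ℕ; zero; suc; NonZero; _≤_; _<_; _∸_; _≤ᵇ_; z≤n; s≤s; _≤?_)
import Data.Nat.DivMod as ℕ
import Data.Nat.Properties as ℕ
open import Data.Product using (_×_; _,_)
open import Data.Sum using (_⊎_; inj₁; inj₂)
open import Data.Unit using (tt)
open import Function using (_∘_; id)
open import Relation.Binary.PropositionalEquality as ≡ using (_≡_; _≗_; cong; cong₂)
open import Relation.Nullary using (yes; no; contradiction)

infixl 6 _-ℕ_
_-ℕ_ : ℤ → ℕ → ℤ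
r -ℕ a = r ℤ.- + a

-ℕ-identityʳ : ∀ r → r -ℕ 0 ≡ r
-ℕ-identityʳ = ℤ.+-identityʳ

-ℕ-+-assoc : ∀ r a b → r -ℕ a -ℕ b ≡ r -ℕ (a ℕ.+ b)
-ℕ-+-assoc r a b = ≡.trans (shuffle r (+ a) (+ b)) (cong (λ z → r ℤ.- z) (≡.sym (ℤ.pos-+ a b)))
  where
  shuffle : ∀ (r a b : ℤ) → r ℤ.- a ℤ.- b ≡ r ℤ.- (a ℤ.+ b)
  shuffle = solve-∀

i-[m+n]+n≡i-m : ∀ r a b → r -ℕ (a ℕ.+ b) ℤ.+ + b ≡ r -ℕ a
i-[m+n]+n≡i-m r a b = ≡.trans (cong (λ z → r ℤ.- z ℤ.+ + b) (ℤ.pos-+ a b)) (cancel r (+ a) (+ b))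
  where
  cancel : ∀ (r a b : ℤ) → r ℤ.- (a ℤ.+ b) ℤ.+ b ≡ r ℤ.- a
  cancel = solve-∀

index-differs-by-period : ∀ r i L N s →
  r ℤ.+ + suc (i ℕ.+ L) -ℕ i ℤ.- ℤ.1ℤ -ℕ s ≡ r -ℕ L ℕ.* N -ℕ s ℤ.+ + (L ℕ.* suc N)
index-differs-by-period r i L N s rewrite ℕ.*-suc L N | ℤ.pos-+ L (L ℕ.* N) | ℤ.pos-+ i L =
  identity r (+ i) (+ L) (+ (L ℕ.* N)) (+ s)
  where
  identity : ∀ (r i L M s : ℤ) →
             r ℤ.+ (ℤ.1ℤ ℤ.+ (i ℤ.+ L)) ℤ.- i ℤ.- ℤ.1ℤ ℤ.- s ≡ r ℤ.- M ℤ.- s ℤ.+ (L ℤ.+ M)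
  identity = solve-∀

≤ᵇ-suc : ∀ a b → (suc a ≤ᵇ suc b) ≡ (a ≤ᵇ b)
≤ᵇ-suc zero    b = ≡.refl
≤ᵇ-suc (suc a) b = ≡.refl

m<m+n∸o : ∀ m {n o} → o < n → m < m ℕ.+ n ∸ o
m<m+n∸o m {n} o<n rewrite ℕ.+-∸-assoc m (ℕ.<⇒≤ o<n) = ℕ.m<m+n m (ℕ.m<n⇒0<n∸m o<n)

module _ (n : ℕ) .{{_ : NonZero n}} where

  private
    negMod : ℕ → ℕ
    negMod zero    = 0
    negMod (suc r) = n ∸ suc r

    -[1+a]%ℕn : ∀ a → -[1+ a ] ℤ.%ℕ n ≡ negMod (suc a ℕ.% n)
    -[1+a]%ℕn a with suc a ℕ.% n
    ... | zero  = ≡.refl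
    ... | suc _ = ≡.refl

  [i+n]%ℕn≡i%ℕn : ∀ i → (i ℤ.+ + n) ℤ.%ℕ n ≡ i ℤ.%ℕ n
  [i+n]%ℕn≡i%ℕn (+ m)    = ℕ.[m+n]%n≡m%n m n
  [i+n]%ℕn≡i%ℕn -[1+ m ] with suc m ≤? n
  ... | yes m<n = ≡.trans (cong (ℤ._%ℕ n) (ℤ.⊖-≥ m<n))
                          (≡.sym (≡.trans (-[1+a]%ℕn m) (wraps (ℕ.m≤n⇒m<n∨m≡n m<n))))
    where
    wraps : suc m < n ⊎ suc m ≡ n → negMod (suc m ℕ.% n) ≡ (n ∸ suc m) ℕ.% n
    wraps (inj₁ m+1<n)  = ≡.trans (cong negMod (ℕ.m<n⇒m%n≡m m+1<n))
                                  (≡.sym (ℕ.m<n⇒m%n≡m (ℕ.∸-monoʳ-< (s≤s z≤n) m<n)))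
    wraps (inj₂ ≡.refl) = ≡.trans (cong negMod (ℕ.n%n≡0 (suc m))) (cong (ℕ._% suc m) (≡.sym (ℕ.n∸n≡0 m)))
  ... | no m≮n = begin
    (n ℤ.⊖ suc m) ℤ.%ℕ n        ≡⟨ cong (ℤ._%ℕ n) (≡.trans (ℤ.⊖-< n<m+1)
                                                           (cong (λ k → ℤ.- + k) (ℕ.+-∸-assoc 1 n≤m))) ⟩
    -[1+ m ∸ n ] ℤ.%ℕ n         ≡⟨ -[1+a]%ℕn (m ∸ n) ⟩
    negMod (suc (m ∸ n) ℕ.% n)  ≡⟨ cong negMod (≡.trans (≡.sym (ℕ.[m+n]%n≡m%n (suc (m ∸ n)) n))
                                                        (cong (λ k → suc k ℕ.% n) (ℕ.m∸n+n≡m n≤m))) ⟩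
    negMod (suc m ℕ.% n)        ≡⟨ -[1+a]%ℕn m ⟨
    -[1+ m ] ℤ.%ℕ n             ∎
    where
    open ≡.≡-Reasoning
    n<m+1 = ℕ.≰⇒> m≮n
    n≤m = ℕ.≤-pred n<m+1

  [i+kn]%ℕn≡i%ℕn : ∀ i k → (i ℤ.+ + (k ℕ.* n)) ℤ.%ℕ n ≡ i ℤ.%ℕ n
  [i+kn]%ℕn≡i%ℕn i zero    = cong (ℤ._%ℕ n) (ℤ.+-identityʳ i)
  [i+kn]%ℕn≡i%ℕn i (suc k) = begin
    (i ℤ.+ + (n ℕ.+ k ℕ.* n)) ℤ.%ℕ n   ≡⟨ cong (ℤ._%ℕ n) (≡.trans (cong (λ z → i ℤ.+ z) (ℤ.pos-+ n (k ℕ.* n)))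
                                                                (≡.sym (ℤ.+-assoc i (+ n) _))) ⟩
    (i ℤ.+ + n ℤ.+ + (k ℕ.* n)) ℤ.%ℕ n ≡⟨ [i+kn]%ℕn≡i%ℕn (i ℤ.+ + n) k ⟩
    (i ℤ.+ + n) ℤ.%ℕ n                 ≡⟨ [i+n]%ℕn≡i%ℕn i ⟩
    i ℤ.%ℕ n                           ∎
    where open ≡.≡-Reasoning

applyUpTo-cong : ∀ {a} {A : Set a} {f g : ℕ → A} → f ≗ g → ∀ n → applyUpTo f n ≡ applyUpTo g n
applyUpTo-cong {f = f} {g} f≗g n =
  ≡.trans (≡.sym (List.map-upTo f n)) (≡.trans (List.map-cong f≗g (upTo n)) (List.map-upTo g n))

[1+m+n]∸m≡1+n : ∀ m n → suc (m ℕ.+ n) ∸ m ≡ suc n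
[1+m+n]∸m≡1+n m n = ≡.trans (ℕ.+-∸-assoc 1 (ℕ.m≤m+n m n)) (cong suc (ℕ.m+n∸m≡n m n))

m*[1+n+o∸n]≡m+o*m : ∀ m n o → m ℕ.* (suc (n ℕ.+ o) ∸ n) ≡ m ℕ.+ o ℕ.* m
m*[1+n+o∸n]≡m+o*m m n o =
  ≡.trans (cong (m ℕ.*_) ([1+m+n]∸m≡1+n n o)) (≡.trans (ℕ.*-suc m o) (cong (m ℕ.+_) (ℕ.*-comm m o)))

m*[1+n+o∸n∸1]≡o*m : ∀ m n o → m ℕ.* (suc (n ℕ.+ o) ∸ n ∸ 1) ≡ o ℕ.* m
m*[1+n+o∸n∸1]≡o*m m n o = ≡.trans (cong (λ d → m ℕ.* (d ∸ 1)) ([1+m+n]∸m≡1+n n o)) (ℕ.*-comm m o)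

module _ {a} {A : Set a} (x : ℕ → A) where

  segment-+ : ∀ i L → segment x i (i ℕ.+ L) ≡ applyUpTo (λ t → x (i ℕ.+ t)) (suc L)
  segment-+ i L =
    ≡.trans (cong (λ d → map (λ t → x (i ℕ.+ t)) (upTo (suc d))) (ℕ.m+n∸m≡n i L)) (List.map-upTo _ (suc L))

  interior : ℕ → ℕ → List A
  interior i L = applyUpTo (λ t → x (suc (i ℕ.+ t))) L

  length-interior : ∀ i L → length (interior i L) ≡ L
  length-interior i L = List.length-applyUpTo _ L

  segment-∷ : ∀ i L → segment x i (i ℕ.+ L) ≡ x i ∷ interior i L
  segment-∷ i L = ≡.trans (segment-+ i L)
                          (cong₂ _∷_ (cong x (ℕ.+-identityʳ i)) (applyUpTo-cong (λ t → cong x (ℕ.+-suc i t)) L))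

  segment-∷ʳ : ∀ i L → segment x (suc i) (suc (i ℕ.+ L)) ≡ interior i L ∷ʳ x (suc (i ℕ.+ L))
  segment-∷ʳ i L = ≡.trans (segment-+ (suc i) L) (≡.sym (List.applyUpTo-∷ʳ _ L))

  segment-∷-∷ʳ : ∀ i L → segment x i (suc (i ℕ.+ L)) ≡ x i ∷ (interior i L ∷ʳ x (suc (i ℕ.+ L)))
  segment-∷-∷ʳ i L = ≡.trans (cong (segment x i) (≡.sym (ℕ.+-suc i L)))
                             (≡.trans (segment-∷ i (suc L)) (cong (x i ∷_) (≡.sym (List.applyUpTo-∷ʳ _ L))))

-- Admissible index sequences

module _ {c ℓ} (R : CommutativeSemiring c ℓ) (N : ℕ) where

  -- N is the paper's n - 1, the longest allowed run of a repeated index.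
  private
    n : ℕ
    n = suc N

  open ≡.≡-Reasoning

  nondecreasing-0∷ : ∀ {L} (t : List (Fin (suc L))) → nondecreasing R n (zero ∷ t) ≡ nondecreasing R n t
  nondecreasing-0∷ []      = ≡.refl
  nondecreasing-0∷ (_ ∷ _) = ≡.refl

  nondecreasing-replicate-0 : ∀ {L} b (t : List (Fin (suc L))) →
    nondecreasing R n (replicate b zero ++ t) ≡ nondecreasing R n t
  nondecreasing-replicate-0 zero    t = ≡.refl
  nondecreasing-replicate-0 (suc b) t =
    ≡.trans (nondecreasing-0∷ (replicate b zero ++ t)) (nondecreasing-replicate-0 b t)

  nondecreasing-map-suc : ∀ {L} (s : List (Fin L)) → nondecreasing R n (map suc s) ≡ nondecreasing R n s
  nondecreasing-map-suc []          = ≡.refl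
  nondecreasing-map-suc (_ ∷ [])    = ≡.refl
  nondecreasing-map-suc (i ∷ j ∷ s) = cong₂ _∧_ (≤ᵇ-suc (toℕ i) (toℕ j)) (nondecreasing-map-suc (j ∷ s))

  nondecreasing-descent : ∀ {L} b (i : Fin L) pre (s : List (Fin (suc L))) →
    nondecreasing R n (replicate b zero ++ suc i ∷ map suc pre ++ zero ∷ s) ≡ false
  nondecreasing-descent b i pre s = ≡.trans (nondecreasing-replicate-0 b _) (descent i pre)
    where
    descent : ∀ i pre → nondecreasing R n (suc i ∷ map suc pre ++ zero ∷ s) ≡ false
    descent i []        = ≡.refl
    descent i (p ∷ pre) = ≡.trans (cong (_ ∧_) (descent p pre)) (Bool.∧-zeroʳ _)

  count-0-map-suc : ∀ {L} (s : List (Fin L)) → count R n zero (map suc s) ≡ 0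
  count-0-map-suc []      = ≡.refl
  count-0-map-suc (_ ∷ s) = count-0-map-suc s

  count-0-leading-zeros : ∀ {L} b (s : List (Fin L)) → count R n zero (replicate b zero ++ map suc s) ≡ b
  count-0-leading-zeros zero    s = count-0-map-suc s
  count-0-leading-zeros (suc b) s = cong suc (count-0-leading-zeros b s)

  count-suc-map-suc : ∀ {L} (v : Fin L) s → count R n (suc v) (map suc s) ≡ count R n v s
  count-suc-map-suc v []      = ≡.refl
  count-suc-map-suc v (i ∷ s) with toℕ v ℕ.≡ᵇ toℕ i
  ... | true  = cong suc (count-suc-map-suc v s)
  ... | false = count-suc-map-suc v s

  count-suc-leading-zeros : ∀ {L} b (v : Fin L) s →
    count R n (suc v) (replicate b zero ++ map suc s) ≡ count R n v s
  count-suc-leading-zeros zero    v s = count-suc-map-suc v s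
  count-suc-leading-zeros (suc b) v s = count-suc-leading-zeros b v s

  allB-++ : ∀ {A : Set} (p : A → Bool) xs ys → allB R n p (xs ++ ys) ≡ (allB R n p xs ∧ allB R n p ys)
  allB-++ p []       ys = ≡.refl
  allB-++ p (x ∷ xs) ys = ≡.trans (cong (p x ∧_) (allB-++ p xs ys)) (≡.sym (Bool.∧-assoc (p x) _ _))

  allB-map : ∀ {A B : Set} (p : B → Bool) (f : A → B) xs → allB R n p (map f xs) ≡ allB R n (p ∘ f) xs
  allB-map p f []       = ≡.refl
  allB-map p f (x ∷ xs) = cong (p (f x) ∧_) (allB-map p f xs)

  allB-cong : ∀ {A : Set} {p q : A → Bool} xs → p ≗ q → allB R n p xs ≡ allB R n q xs
  allB-cong []       p≗q = ≡.refl
  allB-cong (x ∷ xs) p≗q = cong₂ _∧_ (p≗q x) (allB-cong xs p≗q)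

  allB-replicate : ∀ {A : Set} (p : A → Bool) b x → allB R n p (replicate (suc b) x) ≡ p x
  allB-replicate p zero    x = Bool.∧-identityʳ (p x)
  allB-replicate p (suc b) x = ≡.trans (cong (p x ∧_) (allB-replicate p b x)) (Bool.∧-idem (p x))

  admissible-leading-zeros : ∀ {L} b (s : List (Fin L)) →
    admissible R n (replicate b zero ++ map suc s) ≡ ((b ≤ᵇ N) ∧ admissible R n s)
  admissible-leading-zeros {L} b s = begin
    nondecreasing R n w ∧ allB R n bounded w
      ≡⟨ cong₂ _∧_ (≡.trans (nondecreasing-replicate-0 b (map suc s)) (nondecreasing-map-suc s))
                   (allB-++ bounded (replicate b zero) (map suc s)) ⟩
    nondecreasing R n s ∧ (allB R n bounded (replicate b zero) ∧ allB R n bounded (map suc s))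
      ≡⟨ cong (λ z → nondecreasing R n s ∧ (z ∧ allB R n bounded (map suc s))) (zeros-bounded b ≡.refl) ⟩
    nondecreasing R n s ∧ ((b ≤ᵇ N) ∧ allB R n bounded (map suc s))
      ≡⟨ cong (λ z → nondecreasing R n s ∧ ((b ≤ᵇ N) ∧ z))
              (≡.trans (allB-map bounded suc s)
                       (allB-cong s (λ v → cong (_≤ᵇ N) (count-suc-leading-zeros b v s)))) ⟩
    nondecreasing R n s ∧ ((b ≤ᵇ N) ∧ allB R n (λ v → count R n v s ≤ᵇ N) s)
      ≡⟨ swap-∧ (nondecreasing R n s) (b ≤ᵇ N) _ ⟩
    (b ≤ᵇ N) ∧ admissible R n s ∎
    where
    w = replicate b zero ++ map suc s
    bounded : Fin (suc L) → Bool
    bounded v = count R n v w ≤ᵇ N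
    zeros-bounded : ∀ b′ → b′ ≡ b → allB R n bounded (replicate b′ zero) ≡ (b ≤ᵇ N)
    zeros-bounded zero     b≡0 = cong (_≤ᵇ N) b≡0
    zeros-bounded (suc b′) _   =
      ≡.trans (allB-replicate bounded b′ zero) (cong (_≤ᵇ N) (count-0-leading-zeros b s))
    swap-∧ : ∀ x y z → (x ∧ (y ∧ z)) ≡ (y ∧ (x ∧ z))
    swap-∧ x y z =
      ≡.trans (≡.sym (Bool.∧-assoc x y z)) (≡.trans (cong (_∧ z) (Bool.∧-comm x y)) (Bool.∧-assoc y x z))

module _ {c ℓ} (R : CommutativeSemiring c ℓ) (N : ℕ) where

  private
    n : ℕ
    n = suc N

  open CommutativeSemiring R hiding (zero)
  open import Relation.Binary.Reasoning.Setoid setoid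
  open import Algebra.Properties.CommutativeSemigroup +-commutativeSemigroup
    using () renaming (interchange to +-interchange)

  Vector : Set c
  Vector = Vecₙ R n

  infix 10 _⟨_⟩
  _⟨_⟩ : Vector → ℤ → Carrier
  _⟨_⟩ = comp R n

  comp-periodic : ∀ (y : Vector) r k → y ⟨ r ℤ.+ + (k ℕ.* n) ⟩ ≡ y ⟨ r ⟩
  comp-periodic y r k = cong y (Fin.fromℕ<-cong _ _ ([i+kn]%ℕn≡i%ℕn n r k) _ _)

  ∑ : ℕ → (ℕ → Carrier) → Carrier
  ∑ = sumTo R n

  ∏ : ℕ → (ℕ → Carrier) → Carrier
  ∏ = prodBelow R n

  ∑-cong : ∀ K {f g : ℕ → Carrier} → (∀ a → a ≤ K → f a ≈ g a) → ∑ K f ≈ ∑ K g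
  ∑-cong zero    f≈g = f≈g 0 z≤n
  ∑-cong (suc K) f≈g = +-cong (∑-cong K (λ a a≤K → f≈g a (ℕ.m≤n⇒m≤1+n a≤K))) (f≈g (suc K) ℕ.≤-refl)

  ∑-zero : ∀ K {f : ℕ → Carrier} → (∀ a → a ≤ K → f a ≈ 0#) → ∑ K f ≈ 0#
  ∑-zero zero    f≈0 = f≈0 0 z≤n
  ∑-zero (suc K) f≈0 =
    trans (+-cong (∑-zero K (λ a a≤K → f≈0 a (ℕ.m≤n⇒m≤1+n a≤K))) (f≈0 (suc K) ℕ.≤-refl)) (+-identityʳ 0#)

  ∑-+ : ∀ K (f g : ℕ → Carrier) → ∑ K (λ a → f a + g a) ≈ ∑ K f + ∑ K g
  ∑-+ zero    f g = refl
  ∑-+ (suc K) f g = begin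
    ∑ K (λ a → f a + g a) + (f (suc K) + g (suc K)) ≈⟨ +-congʳ (∑-+ K f g) ⟩
    ∑ K f + ∑ K g + (f (suc K) + g (suc K))         ≈⟨ +-interchange (∑ K f) (∑ K g) _ _ ⟩
    ∑ K f + f (suc K) + (∑ K g + g (suc K))         ∎

  ∑-distribʳ : ∀ K (f : ℕ → Carrier) x → ∑ K f * x ≈ ∑ K (λ a → f a * x)
  ∑-distribʳ zero    f x = refl
  ∑-distribʳ (suc K) f x = trans (distribʳ x _ _) (+-congʳ (∑-distribʳ K f x))

  ∑-distribˡ : ∀ K (f : ℕ → Carrier) x → x * ∑ K f ≈ ∑ K (λ a → x * f a)
  ∑-distribˡ zero    f x = refl
  ∑-distribˡ (suc K) f x = trans (distribˡ x _ _) (+-congʳ (∑-distribˡ K f x))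

  ∑-suc : ∀ K (f : ℕ → Carrier) → ∑ (suc K) f ≈ f 0 + ∑ K (f ∘ suc)
  ∑-suc zero    f = refl
  ∑-suc (suc K) f = trans (+-congʳ (∑-suc K f)) (+-assoc _ _ _)

  ∑-dropˡ : ∀ k K (f : ℕ → Carrier) → (∀ a → a < k → f a ≈ 0#) →
            ∑ (k ℕ.+ K) f ≈ ∑ K (λ b → f (k ℕ.+ b))
  ∑-dropˡ zero    K f f≈0 = refl
  ∑-dropˡ (suc k) K f f≈0 = begin
    ∑ (suc (k ℕ.+ K)) f               ≈⟨ ∑-suc (k ℕ.+ K) f ⟩
    f 0 + ∑ (k ℕ.+ K) (f ∘ suc)      ≈⟨ +-cong (f≈0 0 (s≤s z≤n))
                                               (∑-dropˡ k K (f ∘ suc) (λ a a<k → f≈0 (suc a) (s≤s a<k))) ⟩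
    0# + ∑ K (λ b → f (suc k ℕ.+ b)) ≈⟨ +-identityˡ _ ⟩
    ∑ K (λ b → f (suc k ℕ.+ b))       ∎

  ∑-dropʳ : ∀ K M (f : ℕ → Carrier) → (∀ a → K < a → f a ≈ 0#) → ∑ (K ℕ.+ M) f ≈ ∑ K f
  ∑-dropʳ K zero    f f≈0 rewrite ℕ.+-identityʳ K = refl
  ∑-dropʳ K (suc M) f f≈0 rewrite ℕ.+-suc K M =
    trans (+-cong (∑-dropʳ K M f f≈0) (f≈0 (suc (K ℕ.+ M)) (s≤s (ℕ.m≤m+n K M)))) (+-identityʳ _)

  ∑-reverse : ∀ K (f : ℕ → Carrier) → ∑ K f ≈ ∑ K (λ a → f (K ∸ a))
  ∑-reverse zero    f = refl
  ∑-reverse (suc K) f = begin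
    ∑ (suc K) f                     ≈⟨ ∑-suc K f ⟩
    f 0 + ∑ K (f ∘ suc)             ≈⟨ +-comm _ _ ⟩
    ∑ K (f ∘ suc) + f 0             ≈⟨ +-cong (trans (∑-reverse K (f ∘ suc)) (∑-cong K shift))
                                              (reflexive (cong f (≡.sym (ℕ.n∸n≡0 K)))) ⟩
    ∑ (suc K) (λ a → f (suc K ∸ a)) ∎
    where
    shift : ∀ a → a ≤ K → f (suc (K ∸ a)) ≈ f (suc K ∸ a)
    shift a a≤K = reflexive (cong f (≡.sym (ℕ.+-∸-assoc 1 a≤K)))

  ∑-triangle : ∀ K (h : ℕ → ℕ → Carrier) →
               ∑ K (λ a → ∑ a (λ b → h b (a ∸ b))) ≈ ∑ K (λ b → ∑ (K ∸ b) (h b))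
  ∑-triangle zero    h = refl
  ∑-triangle (suc K) h = begin
    ∑ K (λ a → ∑ a (λ b → h b (a ∸ b))) + (∑ K (λ b → h b (suc K ∸ b)) + h (suc K) (K ∸ K))
      ≈⟨ +-assoc _ _ _ ⟨
    ∑ K (λ a → ∑ a (λ b → h b (a ∸ b))) + ∑ K (λ b → h b (suc K ∸ b)) + h (suc K) (K ∸ K)
      ≈⟨ +-congʳ (+-congʳ (∑-triangle K h)) ⟩
    ∑ K (λ b → ∑ (K ∸ b) (h b)) + ∑ K (λ b → h b (suc K ∸ b)) + h (suc K) (K ∸ K)
      ≈⟨ +-cong (sym (∑-+ K _ _)) (reflexive (cong (h (suc K)) (ℕ.n∸n≡0 K))) ⟩
    ∑ K (λ b → ∑ (K ∸ b) (h b) + h b (suc K ∸ b)) + h (suc K) 0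
      ≈⟨ +-cong (∑-cong K (λ b b≤K → reflexive (last-term b b≤K)))
                (reflexive (cong (λ k → ∑ k (h (suc K))) (≡.sym (ℕ.n∸n≡0 K)))) ⟩
    ∑ (suc K) (λ b → ∑ (suc K ∸ b) (h b)) ∎
    where
    last-term : ∀ b → b ≤ K → ∑ (K ∸ b) (h b) + h b (suc K ∸ b) ≡ ∑ (suc K ∸ b) (h b)
    last-term b b≤K rewrite ℕ.+-∸-assoc 1 b≤K = ≡.refl

  ∏-cong : ∀ b {f g : ℕ → Carrier} → (∀ t → f t ≈ g t) → ∏ b f ≈ ∏ b g
  ∏-cong zero    f≈g = refl
  ∏-cong (suc b) f≈g = *-cong (∏-cong b f≈g) (f≈g b)

  ∏-suc : ∀ b (f : ℕ → Carrier) → ∏ (suc b) f ≈ f 0 * ∏ b (f ∘ suc)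
  ∏-suc zero    f = trans (*-identityˡ _) (sym (*-identityʳ _))
  ∏-suc (suc b) f = trans (*-congʳ (∏-suc b f)) (*-assoc _ _ _)

  ∏-+ : ∀ a b (f : ℕ → Carrier) → ∏ (a ℕ.+ b) f ≈ ∏ a f * ∏ b (λ t → f (a ℕ.+ t))
  ∏-+ a zero    f rewrite ℕ.+-identityʳ a = sym (*-identityʳ _)
  ∏-+ a (suc b) f rewrite ℕ.+-suc a b = trans (*-congʳ (∏-+ a b f)) (*-assoc _ _ _)

  -- Twisted convolution

  Series : Set c
  Series = ℕ → ℤ → Carrier

  infix 4 _≋_
  _≋_ : Series → Series → Set ℓ
  F ≋ G = ∀ k r → F k r ≈ G k r

  infixl 7 _⊛_
  _⊛_ : Series → Series → Series
  (F ⊛ G) k r = ∑ k (λ a → F a r * G (k ∸ a) (r -ℕ a))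

  δ : Series
  δ zero    r = 1#
  δ (suc k) r = 0#

  VanishesAbove : ℕ → Series → Set ℓ
  VanishesAbove K F = ∀ k r → K < k → F k r ≈ 0#

  Multiplicative : Series → Set ℓ
  Multiplicative F = ∀ a b r → F (a ℕ.+ b) r ≈ F a r * F b (r -ℕ a)

  δ-vanishes : VanishesAbove 0 δ
  δ-vanishes (suc k) r _ = refl

  vanishesAbove-resp-≋ : ∀ {K F G} → F ≋ G → VanishesAbove K F → VanishesAbove K G
  vanishesAbove-resp-≋ F≋G F≈0 k r K<k = trans (sym (F≋G k r)) (F≈0 k r K<k)

  ⊛-congˡ : ∀ {F F′} G → F ≋ F′ → F ⊛ G ≋ F′ ⊛ G
  ⊛-congˡ G F≋F′ k r = ∑-cong k (λ a _ → *-congʳ (F≋F′ a r))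

  ⊛-congʳ : ∀ F {G G′} → G ≋ G′ → F ⊛ G ≋ F ⊛ G′
  ⊛-congʳ F G≋G′ k r = ∑-cong k (λ a _ → *-congˡ (G≋G′ (k ∸ a) (r -ℕ a)))

  ⊛-identityˡ : ∀ F → δ ⊛ F ≋ F
  ⊛-identityˡ F zero    r = trans (*-identityˡ _) (reflexive (cong (F 0) (-ℕ-identityʳ r)))
  ⊛-identityˡ F (suc k) r = begin
    ∑ (suc k) (λ a → δ a r * F (suc k ∸ a) (r -ℕ a)) ≈⟨ ∑-suc k _ ⟩
    1# * F (suc k) (r -ℕ 0) + ∑ k (λ a → 0# * _)    ≈⟨ +-cong (*-identityˡ _) (∑-zero k (λ a _ → zeroˡ _)) ⟩
    F (suc k) (r -ℕ 0) + 0#                          ≈⟨ +-identityʳ _ ⟩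
    F (suc k) (r -ℕ 0)                               ≡⟨ cong (F (suc k)) (-ℕ-identityʳ r) ⟩
    F (suc k) r                                      ∎

  ⊛-identityʳ : ∀ F → F ⊛ δ ≋ F
  ⊛-identityʳ F zero    r = *-identityʳ _
  ⊛-identityʳ F (suc k) r = begin
    ∑ k (λ a → F a r * δ (suc k ∸ a) (r -ℕ a)) + F (suc k) r * δ (k ∸ k) (r -ℕ suc k)
      ≈⟨ +-cong (∑-zero k (λ a a≤k → trans (*-congˡ (reflexive (cong (λ b → δ b (r -ℕ a)) (ℕ.+-∸-assoc 1 a≤k))))
                                           (zeroʳ _)))
                (trans (*-congˡ (reflexive (cong (λ b → δ b (r -ℕ suc k)) (ℕ.n∸n≡0 k)))) (*-identityʳ _)) ⟩
    0# + F (suc k) r ≈⟨ +-identityˡ _ ⟩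
    F (suc k) r      ∎

  ⊛-assoc : ∀ F G H → (F ⊛ G) ⊛ H ≋ F ⊛ (G ⊛ H)
  ⊛-assoc F G H K r = begin
    ∑ K (λ a → ∑ a (λ b → F b r * G (a ∸ b) (r -ℕ b)) * H (K ∸ a) (r -ℕ a))
      ≈⟨ ∑-cong K (λ a a≤K → trans (∑-distribʳ a _ _) (∑-cong a (λ b b≤a → regroup a b a≤K b≤a))) ⟩
    ∑ K (λ a → ∑ a (λ b → h b (a ∸ b)))
      ≈⟨ ∑-triangle K h ⟩
    ∑ K (λ b → ∑ (K ∸ b) (h b))
      ≈⟨ ∑-cong K (λ b _ → sym (∑-distribˡ (K ∸ b) _ _)) ⟩
    ∑ K (λ b → F b r * (G ⊛ H) (K ∸ b) (r -ℕ b)) ∎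
    where
    h : ℕ → ℕ → Carrier
    h b c = F b r * (G c (r -ℕ b) * H (K ∸ b ∸ c) (r -ℕ b -ℕ c))
    regroup : ∀ a b → a ≤ K → b ≤ a → F b r * G (a ∸ b) (r -ℕ b) * H (K ∸ a) (r -ℕ a) ≈ h b (a ∸ b)
    regroup a b a≤K b≤a = trans (*-assoc _ _ _) (*-congˡ (*-congˡ (reflexive (cong₂ H degree index))))
      where
      degree : K ∸ a ≡ K ∸ b ∸ (a ∸ b)
      degree = ≡.trans (cong (K ∸_) (≡.sym (ℕ.m+[n∸m]≡n b≤a))) (≡.sym (ℕ.∸-+-assoc K b (a ∸ b)))
      index : r -ℕ a ≡ r -ℕ b -ℕ (a ∸ b)
      index = ≡.trans (cong (r -ℕ_) (≡.sym (ℕ.m+[n∸m]≡n b≤a))) (≡.sym (-ℕ-+-assoc r b (a ∸ b)))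

  ⊛-vanishesAbove : ∀ {K L F G} → VanishesAbove K F → VanishesAbove L G → VanishesAbove (K ℕ.+ L) (F ⊛ G)
  ⊛-vanishesAbove {K} {L} {F} {G} F≈0 G≈0 k r K+L<k = ∑-zero k term≈0
    where
    term≈0 : ∀ a → a ≤ k → F a r * G (k ∸ a) (r -ℕ a) ≈ 0#
    term≈0 a _ with a ≤? K
    ... | yes a≤K = trans (*-congˡ (G≈0 _ _ L<k∸a)) (zeroʳ _)
      where
      L<k∸a : L < k ∸ a
      L<k∸a = ℕ.m+n≤o⇒m≤o∸n (suc L)
                (ℕ.≤-trans (ℕ.+-monoʳ-≤ (suc L) a≤K) (≡.subst (λ s → suc s ≤ k) (ℕ.+-comm K L) K+L<k))
    ... | no a≰K = trans (*-congʳ (F≈0 a r (ℕ.≰⇒> a≰K))) (zeroˡ _)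

  ⊛-boundedʳ : ∀ {M G} F → VanishesAbove M G → ∀ K r →
               (F ⊛ G) (M ℕ.+ K) r ≈ ∑ M (λ k → F (K ℕ.+ k) r * G (M ∸ k) (r -ℕ (K ℕ.+ k)))
  ⊛-boundedʳ {M} {G} F G≈0 K r = begin
    ∑ (M ℕ.+ K) f           ≡⟨ cong (λ d → ∑ d f) (ℕ.+-comm M K) ⟩
    ∑ (K ℕ.+ M) f
      ≈⟨ ∑-dropˡ K M f (λ a a<K → trans (*-congˡ (G≈0 _ _ (m<m+n∸o M a<K))) (zeroʳ _)) ⟩
    ∑ M (λ k → f (K ℕ.+ k))
      ≈⟨ ∑-cong M (λ k _ → *-congˡ (reflexive (cong (λ d → G d (r -ℕ (K ℕ.+ k))) degree))) ⟩
    ∑ M (λ k → F (K ℕ.+ k) r * G (M ∸ k) (r -ℕ (K ℕ.+ k))) ∎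
    where
    f : ℕ → Carrier
    f a = F a r * G (M ℕ.+ K ∸ a) (r -ℕ a)
    degree : ∀ {k} → M ℕ.+ K ∸ (K ℕ.+ k) ≡ M ∸ k
    degree {k} = ≡.trans (cong (_∸ (K ℕ.+ k)) (ℕ.+-comm M K)) (ℕ.[m+n]∸[m+o]≡n∸o K M k)

  ⊛-top-factorˡ : ∀ {K F G} → Multiplicative F → VanishesAbove K G → ∀ k r →
                  (F ⊛ G) (K ℕ.+ k) r ≈ F k r * (F ⊛ G) K (r -ℕ k)
  ⊛-top-factorˡ {K} {F} {G} F-mult G≈0 k r = begin
    ∑ (K ℕ.+ k) f           ≡⟨ cong (λ d → ∑ d f) (ℕ.+-comm K k) ⟩
    ∑ (k ℕ.+ K) f
      ≈⟨ ∑-dropˡ k K f (λ a a<k → trans (*-congˡ (G≈0 _ _ (m<m+n∸o K a<k))) (zeroʳ _)) ⟩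
    ∑ K (λ c → f (k ℕ.+ c))
      ≈⟨ ∑-cong K (λ c _ → split c) ⟩
    ∑ K (λ c → F k r * (F c (r -ℕ k) * G (K ∸ c) (r -ℕ k -ℕ c)))
      ≈⟨ sym (∑-distribˡ K _ _) ⟩
    F k r * (F ⊛ G) K (r -ℕ k) ∎
    where
    f : ℕ → Carrier
    f a = F a r * G (K ℕ.+ k ∸ a) (r -ℕ a)
    split : ∀ c → f (k ℕ.+ c) ≈ F k r * (F c (r -ℕ k) * G (K ∸ c) (r -ℕ k -ℕ c))
    split c = trans (*-cong (F-mult k c r) (reflexive (cong₂ G degree (≡.sym (-ℕ-+-assoc r k c))))) (*-assoc _ _ _)
      where
      degree : K ℕ.+ k ∸ (k ℕ.+ c) ≡ K ∸ c
      degree = ≡.trans (cong (_∸ (k ℕ.+ c)) (ℕ.+-comm K k)) (ℕ.[m+n]∸[m+o]≡n∸o k K c)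

  ⊛-top-factorʳ : ∀ {K F G} → VanishesAbove K F → Multiplicative G → ∀ b r →
                  (F ⊛ G) (K ℕ.+ b) r ≈ (F ⊛ G) K r * G b (r -ℕ K)
  ⊛-top-factorʳ {K} {F} {G} F≈0 G-mult b r = begin
    ∑ (K ℕ.+ b) f ≈⟨ ∑-dropʳ K b f (λ a K<a → trans (*-congʳ (F≈0 a r K<a)) (zeroˡ _)) ⟩
    ∑ K f         ≈⟨ ∑-cong K split ⟩
    ∑ K (λ a → F a r * G (K ∸ a) (r -ℕ a) * G b (r -ℕ K)) ≈⟨ sym (∑-distribʳ K _ _) ⟩
    (F ⊛ G) K r * G b (r -ℕ K) ∎
    where
    f : ℕ → Carrier
    f a = F a r * G (K ℕ.+ b ∸ a) (r -ℕ a)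
    split : ∀ a → a ≤ K → f a ≈ F a r * G (K ∸ a) (r -ℕ a) * G b (r -ℕ K)
    split a a≤K = begin
      F a r * G (K ℕ.+ b ∸ a) (r -ℕ a)
        ≡⟨ cong (λ d → F a r * G d (r -ℕ a)) (ℕ.+-∸-comm b a≤K) ⟩
      F a r * G (K ∸ a ℕ.+ b) (r -ℕ a)
        ≈⟨ *-congˡ (G-mult (K ∸ a) b (r -ℕ a)) ⟩
      F a r * (G (K ∸ a) (r -ℕ a) * G b (r -ℕ a -ℕ (K ∸ a)))
        ≡⟨ cong (λ s → F a r * (G (K ∸ a) (r -ℕ a) * G b s)) index ⟩
      F a r * (G (K ∸ a) (r -ℕ a) * G b (r -ℕ K))
        ≈⟨ sym (*-assoc _ _ _) ⟩
      F a r * G (K ∸ a) (r -ℕ a) * G b (r -ℕ K) ∎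
      where
      index : r -ℕ a -ℕ (K ∸ a) ≡ r -ℕ K
      index = ≡.trans (-ℕ-+-assoc r a (K ∸ a)) (cong (r -ℕ_) (ℕ.m+[n∸m]≡n a≤K))

  falling : Vector → ℕ → ℤ → Carrier
  falling y b r = ∏ b (λ t → y ⟨ r -ℕ t ⟩)

  falling-suc : ∀ y b r → falling y (suc b) r ≈ y ⟨ r ⟩ * falling y b (r -ℕ 1)
  falling-suc y b r = trans (∏-suc b _) (*-cong (reflexive (cong (y ⟨_⟩) (-ℕ-identityʳ r))) (∏-cong b shift))
    where
    shift : ∀ t → y ⟨ r -ℕ suc t ⟩ ≈ y ⟨ r -ℕ 1 -ℕ t ⟩
    shift t = reflexive (cong (y ⟨_⟩) (≡.sym (-ℕ-+-assoc r 1 t)))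

  falling-multiplicative : ∀ y → Multiplicative (falling y)
  falling-multiplicative y a b r =
    trans (∏-+ a b _) (*-congˡ (∏-cong b (λ t → reflexive (cong (y ⟨_⟩) (≡.sym (-ℕ-+-assoc r a t))))))

  capped : Vector → ℕ → ℤ → Carrier
  capped y b r = if b ≤ᵇ N then falling y b r else 0#

  capped-≤ : ∀ y {b} r → b ≤ N → capped y b r ≈ falling y b r
  capped-≤ y {b} r b≤N with b ≤ᵇ N in eq
  ... | true  = refl
  ... | false = contradiction (ℕ.≤⇒≤ᵇ b≤N) (≡.subst T eq)

  capped-vanishes : ∀ y → VanishesAbove N (capped y)
  capped-vanishes y b r N<b with b ≤ᵇ N in eq
  ... | true  = contradiction (ℕ.≤ᵇ⇒≤ b N (≡.subst T (≡.sym eq) tt)) (ℕ.<⇒≱ N<b)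
  ... | false = refl

  ∑ₗ : List Carrier → Carrier
  ∑ₗ = sumList R n

  ∑ₗ-++ : ∀ xs ys → ∑ₗ (xs ++ ys) ≈ ∑ₗ xs + ∑ₗ ys
  ∑ₗ-++ []       ys = sym (+-identityˡ _)
  ∑ₗ-++ (x ∷ xs) ys = trans (+-congˡ (∑ₗ-++ xs ys)) (sym (+-assoc _ _ _))

  ∑ₗ-map-cong : ∀ {A : Set} (xs : List A) {f g : A → Carrier} → (∀ a → f a ≈ g a) →
                ∑ₗ (map f xs) ≈ ∑ₗ (map g xs)
  ∑ₗ-map-cong []       f≈g = refl
  ∑ₗ-map-cong (x ∷ xs) f≈g = +-cong (f≈g x) (∑ₗ-map-cong xs f≈g)

  ∑ₗ-map-zero : ∀ {A : Set} (xs : List A) {f : A → Carrier} → (∀ a → f a ≈ 0#) → ∑ₗ (map f xs) ≈ 0#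
  ∑ₗ-map-zero []       f≈0 = refl
  ∑ₗ-map-zero (x ∷ xs) f≈0 = trans (+-cong (f≈0 x) (∑ₗ-map-zero xs f≈0)) (+-identityʳ _)

  ∑ₗ-map-+ : ∀ {A : Set} (xs : List A) (f g : A → Carrier) →
             ∑ₗ (map (λ a → f a + g a) xs) ≈ ∑ₗ (map f xs) + ∑ₗ (map g xs)
  ∑ₗ-map-+ []       f g = sym (+-identityʳ _)
  ∑ₗ-map-+ (x ∷ xs) f g = trans (+-congˡ (∑ₗ-map-+ xs f g)) (+-interchange _ _ _ _)

  ∑ₗ-map-distribˡ : ∀ {A : Set} (xs : List A) (f : A → Carrier) x →
                    x * ∑ₗ (map f xs) ≈ ∑ₗ (map (λ a → x * f a) xs)
  ∑ₗ-map-distribˡ []       f x = zeroʳ _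
  ∑ₗ-map-distribˡ (y ∷ xs) f x = trans (distribˡ _ _ _) (+-congˡ (∑ₗ-map-distribˡ xs f x))

  ∑ₗ-swap : ∀ {A B : Set} (xs : List A) (ys : List B) (f : A → B → Carrier) →
            ∑ₗ (map (λ a → ∑ₗ (map (f a) ys)) xs) ≈ ∑ₗ (map (λ b → ∑ₗ (map (λ a → f a b) xs)) ys)
  ∑ₗ-swap []       ys f = sym (∑ₗ-map-zero ys (λ _ → refl))
  ∑ₗ-swap (x ∷ xs) ys f = trans (+-congˡ (∑ₗ-swap xs ys f)) (sym (∑ₗ-map-+ ys (f x) _))

  ∑ₗ-concatMap : ∀ {A B : Set} (h : A → List B) (xs : List A) (φ : B → Carrier) →
                 ∑ₗ (map φ (concatMap h xs)) ≈ ∑ₗ (map (λ a → ∑ₗ (map φ (h a))) xs)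
  ∑ₗ-concatMap h []       φ = refl
  ∑ₗ-concatMap h (x ∷ xs) φ = begin
    ∑ₗ (map φ (h x ++ concatMap h xs))             ≡⟨ cong ∑ₗ (List.map-++ φ (h x) (concatMap h xs)) ⟩
    ∑ₗ (map φ (h x) ++ map φ (concatMap h xs))     ≈⟨ ∑ₗ-++ (map φ (h x)) _ ⟩
    ∑ₗ (map φ (h x)) + ∑ₗ (map φ (concatMap h xs)) ≈⟨ +-congˡ (∑ₗ-concatMap h xs φ) ⟩
    ∑ₗ (map φ (h x)) + ∑ₗ (map (λ a → ∑ₗ (map φ (h a))) xs) ∎

  ∑fin : ∀ L → (Fin L → Carrier) → Carrier
  ∑fin L φ = ∑ₗ (map φ (allFin L))

  ∑fin-suc : ∀ L φ → ∑fin (suc L) φ ≡ φ zero + ∑fin L (φ ∘ suc)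
  ∑fin-suc L φ =
    cong (λ xs → φ zero + ∑ₗ xs) (≡.trans (List.map-tabulate suc φ) (≡.sym (List.map-tabulate id (φ ∘ suc))))

  ∑seq : ∀ L → ℕ → (List (Fin L) → Carrier) → Carrier
  ∑seq L k φ = ∑ₗ (map φ (allSeqs R n L k))

  ∑seq-cong : ∀ L k {φ ψ} → (∀ s → φ s ≈ ψ s) → ∑seq L k φ ≈ ∑seq L k ψ
  ∑seq-cong L k = ∑ₗ-map-cong (allSeqs R n L k)

  ∑seq-suc : ∀ L k φ → ∑seq L (suc k) φ ≈ ∑fin L (λ i → ∑seq L k (φ ∘ (i ∷_)))
  ∑seq-suc L k φ = begin
    ∑seq L (suc k) φ
      ≈⟨ ∑ₗ-concatMap _ (allSeqs R n L k) φ ⟩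
    ∑ₗ (map (λ s → ∑ₗ (map φ (map (_∷ s) (allFin L)))) (allSeqs R n L k))
      ≈⟨ ∑ₗ-map-cong (allSeqs R n L k) (λ s → reflexive (cong ∑ₗ (≡.sym (List.map-∘ (allFin L))))) ⟩
    ∑ₗ (map (λ s → ∑ₗ (map (λ i → φ (i ∷ s)) (allFin L))) (allSeqs R n L k))
      ≈⟨ ∑ₗ-swap (allSeqs R n L k) (allFin L) (λ s i → φ (i ∷ s)) ⟩
    ∑fin L (λ i → ∑seq L k (φ ∘ (i ∷_))) ∎

  ∑seq-map-suc : ∀ L k (φ : List (Fin (suc L)) → Carrier) →
                 (∀ pre s → φ (map suc pre ++ zero ∷ s) ≈ 0#) → ∑seq (suc L) k φ ≈ ∑seq L k (φ ∘ map suc)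
  ∑seq-map-suc L zero    φ _   = refl
  ∑seq-map-suc L (suc k) φ φ≈0 = begin
    ∑seq (suc L) (suc k) φ
      ≈⟨ ∑seq-suc (suc L) k φ ⟩
    ∑fin (suc L) (λ i → ∑seq (suc L) k (φ ∘ (i ∷_)))
      ≡⟨ ∑fin-suc L _ ⟩
    ∑seq (suc L) k (φ ∘ (zero ∷_)) + ∑fin L (λ i → ∑seq (suc L) k (φ ∘ (suc i ∷_)))
      ≈⟨ +-cong (∑ₗ-map-zero (allSeqs R n (suc L) k) (φ≈0 []))
                (∑ₗ-map-cong (allFin L) (λ i → ∑seq-map-suc L k (φ ∘ (suc i ∷_)) (λ pre → φ≈0 (i ∷ pre)))) ⟩
    0# + ∑fin L (λ i → ∑seq L k (φ ∘ map suc ∘ (i ∷_)))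
      ≈⟨ +-identityˡ _ ⟩
    ∑fin L (λ i → ∑seq L k (φ ∘ map suc ∘ (i ∷_)))
      ≈⟨ sym (∑seq-suc L k (φ ∘ map suc)) ⟩
    ∑seq L (suc k) (φ ∘ map suc) ∎

  -- If φ vanishes whenever a 0 occurs after a nonzero entry, only the sequences made of b zeros followed by
  -- k - b nonzero entries contribute.
  ∑seq-leading-zeros : ∀ L k (φ : List (Fin (suc L)) → Carrier) →
    (∀ b i pre s → φ (replicate b zero ++ suc i ∷ map suc pre ++ zero ∷ s) ≈ 0#) →
    ∑seq (suc L) k φ ≈ ∑ k (λ b → ∑seq L (k ∸ b) (λ s → φ (replicate b zero ++ map suc s)))
  ∑seq-leading-zeros L zero    φ _   = refl
  ∑seq-leading-zeros L (suc k) φ φ≈0 = begin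
    ∑seq (suc L) (suc k) φ
      ≈⟨ ∑seq-suc (suc L) k φ ⟩
    ∑fin (suc L) (λ i → ∑seq (suc L) k (φ ∘ (i ∷_)))
      ≡⟨ ∑fin-suc L _ ⟩
    ∑seq (suc L) k (φ ∘ (zero ∷_)) + ∑fin L (λ i → ∑seq (suc L) k (φ ∘ (suc i ∷_)))
      ≈⟨ +-comm _ _ ⟩
    ∑fin L (λ i → ∑seq (suc L) k (φ ∘ (suc i ∷_))) + ∑seq (suc L) k (φ ∘ (zero ∷_))
      ≈⟨ +-cong (∑ₗ-map-cong (allFin L) (λ i → ∑seq-map-suc L k (φ ∘ (suc i ∷_)) (φ≈0 0 i)))
                (∑seq-leading-zeros L k (φ ∘ (zero ∷_)) (φ≈0 ∘ suc)) ⟩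
    ∑fin L (λ i → ∑seq L k (φ ∘ map suc ∘ (i ∷_)))
      + ∑ k (λ b → ∑seq L (k ∸ b) (λ s → φ (replicate (suc b) zero ++ map suc s)))
      ≈⟨ +-congʳ (sym (∑seq-suc L k (φ ∘ map suc))) ⟩
    ∑seq L (suc k) (φ ∘ map suc)
      + ∑ k (λ b → ∑seq L (k ∸ b) (λ s → φ (replicate (suc b) zero ++ map suc s)))
      ≈⟨ sym (∑-suc k _) ⟩
    ∑ (suc k) (λ b → ∑seq L (suc k ∸ b) (λ s → φ (replicate b zero ++ map suc s))) ∎

  -- τ, σ and σ̄ as convolutions

  seqProd-map-suc : ∀ y ys r (s : List (Fin (length ys))) →
                    seqProd R n (y ∷ ys) r (map suc s) ≡ seqProd R n ys r s
  seqProd-map-suc y ys r []      = ≡.refl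
  seqProd-map-suc y ys r (i ∷ s) = cong (_ *_) (seqProd-map-suc y ys (r -ℕ 1) s)

  seqProd-leading-zeros : ∀ y ys b r (t : List (Fin (suc (length ys)))) →
    seqProd R n (y ∷ ys) r (replicate b zero ++ t) ≈ falling y b r * seqProd R n (y ∷ ys) (r -ℕ b) t
  seqProd-leading-zeros y ys zero    r t =
    trans (reflexive (cong (λ s → seqProd R n (y ∷ ys) s t) (≡.sym (-ℕ-identityʳ r)))) (sym (*-identityˡ _))
  seqProd-leading-zeros y ys (suc b) r t = begin
    y ⟨ r ⟩ * seqProd R n (y ∷ ys) (r -ℕ 1) (replicate b zero ++ t)
      ≈⟨ *-congˡ (seqProd-leading-zeros y ys b (r -ℕ 1) t) ⟩
    y ⟨ r ⟩ * (falling y b (r -ℕ 1) * seqProd R n (y ∷ ys) (r -ℕ 1 -ℕ b) t)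
      ≈⟨ sym (*-assoc _ _ _) ⟩
    y ⟨ r ⟩ * falling y b (r -ℕ 1) * seqProd R n (y ∷ ys) (r -ℕ 1 -ℕ b) t
      ≈⟨ *-cong (sym (falling-suc y b r)) (reflexive (cong (λ s → seqProd R n (y ∷ ys) s t) (-ℕ-+-assoc r 1 b))) ⟩
    falling y (suc b) r * seqProd R n (y ∷ ys) (r -ℕ suc b) t ∎

  admissibleTerm : (vs : List Vector) → ℤ → List (Fin (length vs)) → Carrier
  admissibleTerm vs r s = if admissible R n s then seqProd R n vs r s else 0#

  admissibleTerm-leading-zeros : ∀ y ys r b (s : List (Fin (length ys))) →
    admissibleTerm (y ∷ ys) r (replicate b zero ++ map suc s) ≈ capped y b r * admissibleTerm ys (r -ℕ b) s
  admissibleTerm-leading-zeros y ys r b s rewrite admissible-leading-zeros R N b s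
    with b ≤ᵇ N | admissible R n s
  ... | true  | true  = trans (seqProd-leading-zeros y ys b r (map suc s))
                              (*-congˡ (reflexive (seqProd-map-suc y ys (r -ℕ b) s)))
  ... | true  | false = sym (zeroʳ _)
  ... | false | _     = sym (zeroˡ _)

  admissibleTerm-descent : ∀ y ys r b i pre (s : List (Fin (suc (length ys)))) →
    admissibleTerm (y ∷ ys) r (replicate b zero ++ suc i ∷ map suc pre ++ zero ∷ s) ≈ 0#
  admissibleTerm-descent y ys r b i pre s rewrite nondecreasing-descent R N b i pre s = refl

  τˢ : List Vector → Series
  τˢ vs k r = τ R n k r vs

  τ-[] : τˢ [] ≋ δ
  τ-[] zero    r = +-identityʳ _
  τ-[] (suc k) r = ∑seq-suc 0 k _

  τ-∷ : ∀ y ys → τˢ (y ∷ ys) ≋ capped y ⊛ τˢ ys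
  τ-∷ y ys k r = begin
    ∑seq (suc (length ys)) k (admissibleTerm (y ∷ ys) r)
      ≈⟨ ∑seq-leading-zeros (length ys) k (admissibleTerm (y ∷ ys) r) (admissibleTerm-descent y ys r) ⟩
    ∑ k (λ b → ∑seq (length ys) (k ∸ b) (λ s → admissibleTerm (y ∷ ys) r (replicate b zero ++ map suc s)))
      ≈⟨ ∑-cong k (λ b _ → trans (∑seq-cong (length ys) (k ∸ b) (admissibleTerm-leading-zeros y ys r b))
                                 (sym (∑ₗ-map-distribˡ (allSeqs R n (length ys) (k ∸ b)) _ _))) ⟩
    (capped y ⊛ τˢ ys) k r ∎

  τ-∷ʳ : ∀ ys y → τˢ (ys ∷ʳ y) ≋ τˢ ys ⊛ capped y
  τ-∷ʳ []        y k r = begin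
    τˢ [ y ] k r           ≈⟨ τ-∷ y [] k r ⟩
    (capped y ⊛ τˢ []) k r ≈⟨ ⊛-congʳ (capped y) τ-[] k r ⟩
    (capped y ⊛ δ) k r     ≈⟨ ⊛-identityʳ (capped y) k r ⟩
    capped y k r           ≈⟨ ⊛-identityˡ (capped y) k r ⟨
    (δ ⊛ capped y) k r     ≈⟨ ⊛-congˡ (capped y) τ-[] k r ⟨
    (τˢ [] ⊛ capped y) k r ∎
  τ-∷ʳ (y′ ∷ ys) y k r = begin
    τˢ (y′ ∷ ys ∷ʳ y) k r                ≈⟨ τ-∷ y′ (ys ∷ʳ y) k r ⟩
    (capped y′ ⊛ τˢ (ys ∷ʳ y)) k r       ≈⟨ ⊛-congʳ (capped y′) (τ-∷ʳ ys y) k r ⟩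
    (capped y′ ⊛ (τˢ ys ⊛ capped y)) k r ≈⟨ ⊛-assoc (capped y′) (τˢ ys) (capped y) k r ⟨
    (capped y′ ⊛ τˢ ys ⊛ capped y) k r   ≈⟨ ⊛-congˡ (capped y) (τ-∷ y′ ys) k r ⟨
    (τˢ (y′ ∷ ys) ⊛ capped y) k r        ∎

  τ-vanishes : ∀ ys → VanishesAbove (length ys ℕ.* N) (τˢ ys)
  τ-vanishes []       = vanishesAbove-resp-≋ (λ k r → sym (τ-[] k r)) δ-vanishes
  τ-vanishes (y ∷ ys) = vanishesAbove-resp-≋ (λ k r → sym (τ-∷ y ys k r))
                                             (⊛-vanishesAbove (capped-vanishes y) (τ-vanishes ys))

  splitLast-∷ʳ : ∀ ws y → splitLast R n (ws ∷ʳ y) ≡ just (ws , y)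
  splitLast-∷ʳ []       y = ≡.refl
  splitLast-∷ʳ (w ∷ ws) y rewrite splitLast-∷ʳ ws y = ≡.refl

  σ̄-∷ʳ : ∀ K r ws y → σ̄ R n K r (ws ∷ʳ y) ≈ (τˢ ws ⊛ falling y) K r
  σ̄-∷ʳ K r ws y rewrite splitLast-∷ʳ ws y = trans (∑-reverse K _) (∑-cong K reindex)
    where
    reindex : ∀ a → a ≤ K →
              τˢ ws (K ∸ (K ∸ a)) r * ∏ (K ∸ a) (λ t → y ⟨ r -ℕ K ℤ.+ + (K ∸ a) -ℕ t ⟩)
                ≈ τˢ ws a r * falling y (K ∸ a) (r -ℕ a)
    reindex a a≤K = *-cong (reflexive (cong (λ d → τˢ ws d r) (ℕ.m∸[m∸n]≡n a≤K)))
                           (∏-cong (K ∸ a) (λ t → reflexive (cong (λ s → y ⟨ s -ℕ t ⟩) firstIndex)))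
      where
      firstIndex : r -ℕ K ℤ.+ + (K ∸ a) ≡ r -ℕ a
      firstIndex = ≡.trans (cong (λ d → r -ℕ d ℤ.+ + (K ∸ a)) (≡.sym (ℕ.m+[n∸m]≡n a≤K)))
                           (i-[m+n]+n≡i-m r a (K ∸ a))

  σ-top-split : ∀ a zs y {L} → length zs ≡ L → ∀ r → let K = L ℕ.* N in
    σ R n (N ℕ.+ K) r (a ∷ (zs ∷ʳ y))
      ≈ ∑ N (λ k → falling a k r * σ R n K (r -ℕ k) (a ∷ zs) * falling y (N ∸ k) (r -ℕ k -ℕ K))
  σ-top-split a zs y ≡.refl r = begin
    σ R n (N ℕ.+ K) r (a ∷ (zs ∷ʳ y))            ≡⟨⟩
    (falling a ⊛ τˢ (zs ∷ʳ y)) (N ℕ.+ K) r       ≈⟨ ⊛-congʳ (falling a) (τ-∷ʳ zs y) (N ℕ.+ K) r ⟩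
    (falling a ⊛ (τˢ zs ⊛ capped y)) (N ℕ.+ K) r ≈⟨ ⊛-assoc (falling a) (τˢ zs) (capped y) (N ℕ.+ K) r ⟨
    (falling a ⊛ τˢ zs ⊛ capped y) (N ℕ.+ K) r   ≈⟨ ⊛-boundedʳ (falling a ⊛ τˢ zs) (capped-vanishes y) K r ⟩
    ∑ N (λ k → (falling a ⊛ τˢ zs) (K ℕ.+ k) r * capped y (N ∸ k) (r -ℕ (K ℕ.+ k)))
      ≈⟨ ∑-cong N (λ k _ → *-cong (⊛-top-factorˡ (falling-multiplicative a) (τ-vanishes zs) k r) (last-block k)) ⟩
    ∑ N (λ k → falling a k r * (falling a ⊛ τˢ zs) K (r -ℕ k) * falling y (N ∸ k) (r -ℕ k -ℕ K)) ∎
    where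
    K = length zs ℕ.* N
    last-block : ∀ k → capped y (N ∸ k) (r -ℕ (K ℕ.+ k)) ≈ falling y (N ∸ k) (r -ℕ k -ℕ K)
    last-block k = trans (capped-≤ y (r -ℕ (K ℕ.+ k)) (ℕ.m∸n≤m N k))
                         (reflexive (cong (falling y (N ∸ k))
                                          (≡.trans (cong (r -ℕ_) (ℕ.+-comm K k)) (≡.sym (-ℕ-+-assoc r k K)))))

  σ̄-top-split : ∀ a zs y {L} → length zs ≡ L → ∀ r → let K = L ℕ.* N in
    σ̄ R n (N ℕ.+ K) r ((a ∷ zs) ∷ʳ y)
      ≈ ∑ N (λ k → falling a k r * σ̄ R n K (r -ℕ k) (zs ∷ʳ y) * falling y (N ∸ k) (r -ℕ k -ℕ K))
  σ̄-top-split a zs y ≡.refl r = begin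
    σ̄ R n (N ℕ.+ K) r ((a ∷ zs) ∷ʳ y)            ≈⟨ σ̄-∷ʳ (N ℕ.+ K) r (a ∷ zs) y ⟩
    (τˢ (a ∷ zs) ⊛ falling y) (N ℕ.+ K) r        ≈⟨ ⊛-congˡ (falling y) (τ-∷ a zs) (N ℕ.+ K) r ⟩
    (capped a ⊛ τˢ zs ⊛ falling y) (N ℕ.+ K) r   ≈⟨ ⊛-assoc (capped a) (τˢ zs) (falling y) (N ℕ.+ K) r ⟩
    (capped a ⊛ (τˢ zs ⊛ falling y)) (N ℕ.+ K) r
      ≈⟨ ∑-dropʳ N K _ (λ k N<k → trans (*-congʳ (capped-vanishes a k r N<k)) (zeroˡ _)) ⟩
    ∑ N (λ k → capped a k r * (τˢ zs ⊛ falling y) (N ℕ.+ K ∸ k) (r -ℕ k))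
      ≈⟨ ∑-cong N term ⟩
    ∑ N (λ k → falling a k r * σ̄ R n K (r -ℕ k) (zs ∷ʳ y) * falling y (N ∸ k) (r -ℕ k -ℕ K)) ∎
    where
    K = length zs ℕ.* N
    term : ∀ k → k ≤ N → capped a k r * (τˢ zs ⊛ falling y) (N ℕ.+ K ∸ k) (r -ℕ k)
                         ≈ falling a k r * σ̄ R n K (r -ℕ k) (zs ∷ʳ y) * falling y (N ∸ k) (r -ℕ k -ℕ K)
    term k k≤N = begin
      capped a k r * (τˢ zs ⊛ falling y) (N ℕ.+ K ∸ k) (r -ℕ k)
        ≈⟨ *-cong (capped-≤ a r k≤N) (reflexive (cong (λ d → (τˢ zs ⊛ falling y) d (r -ℕ k))
                                                     (≡.trans (ℕ.+-∸-comm K k≤N) (ℕ.+-comm (N ∸ k) K)))) ⟩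
      falling a k r * (τˢ zs ⊛ falling y) (K ℕ.+ (N ∸ k)) (r -ℕ k)
        ≈⟨ *-congˡ (⊛-top-factorʳ (τ-vanishes zs) (falling-multiplicative y) (N ∸ k) (r -ℕ k)) ⟩
      falling a k r * ((τˢ zs ⊛ falling y) K (r -ℕ k) * falling y (N ∸ k) (r -ℕ k -ℕ K))
        ≈⟨ sym (*-assoc _ _ _) ⟩
      falling a k r * (τˢ zs ⊛ falling y) K (r -ℕ k) * falling y (N ∸ k) (r -ℕ k -ℕ K)
        ≈⟨ *-congʳ (*-congˡ (sym (σ̄-∷ʳ K (r -ℕ k) zs y))) ⟩
      falling a k r * σ̄ R n K (r -ℕ k) (zs ∷ʳ y) * falling y (N ∸ k) (r -ℕ k -ℕ K) ∎

  -- The stated formula reads the last block from r - k + (j - i - 1); the split above reads it from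
  -- r - k - (j - i - 1)(n - 1). The two differ by (j - i - 1) n.
  falling-reindex : ∀ y r k i L →
    falling y (N ∸ k) (r -ℕ k -ℕ L ℕ.* N)
      ≈ ∏ (n ∸ k ∸ 1) (λ s → y ⟨ r -ℕ k ℤ.+ + suc (i ℕ.+ L) -ℕ i ℤ.- ℤ.1ℤ -ℕ s ⟩)
  falling-reindex y r k i L =
    trans (reflexive (cong (λ d → falling y d (r -ℕ k -ℕ L ℕ.* N)) (≡.sym (ℕ.pred[m∸n]≡m∸[1+n] n k))))
          (∏-cong (n ∸ k ∸ 1) (λ s → reflexive (≡.sym (period s))))
    where
    period : ∀ s → y ⟨ r -ℕ k ℤ.+ + suc (i ℕ.+ L) -ℕ i ℤ.- ℤ.1ℤ -ℕ s ⟩ ≡ y ⟨ r -ℕ k -ℕ L ℕ.* N -ℕ s ⟩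
    period s = ≡.trans (cong (y ⟨_⟩) (index-differs-by-period (r -ℕ k) i L N s))
                       (comp-periodic y (r -ℕ k -ℕ L ℕ.* N -ℕ s) L)

  σ-segment-split : ∀ (x : ℕ → Vector) i L r → let j = suc (i ℕ.+ L) in
    σ R n (N ℕ.* (j ∸ i)) r (segment x i j)
      ≈ ∑ N (λ k → falling (x i) k r * σ R n (N ℕ.* (j ∸ i ∸ 1)) (r -ℕ k) (segment x i (i ℕ.+ L))
                   * ∏ (n ∸ k ∸ 1) (λ s → x j ⟨ r -ℕ k ℤ.+ + j -ℕ i ℤ.- ℤ.1ℤ -ℕ s ⟩))
  σ-segment-split x i L r = begin
    σ R n (N ℕ.* (j ∸ i)) r (segment x i j)
      ≡⟨ cong₂ (λ d vs → σ R n d r vs) (m*[1+n+o∸n]≡m+o*m N i L) (segment-∷-∷ʳ x i L) ⟩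
    σ R n (N ℕ.+ L ℕ.* N) r (x i ∷ (mid ∷ʳ x j))
      ≈⟨ σ-top-split (x i) mid (x j) (length-interior x i L) r ⟩
    ∑ N (λ k → falling (x i) k r * σ R n (L ℕ.* N) (r -ℕ k) (x i ∷ mid)
               * falling (x j) (N ∸ k) (r -ℕ k -ℕ L ℕ.* N))
      ≈⟨ ∑-cong N (λ k _ → *-cong (*-congˡ (reflexive (lower k))) (falling-reindex (x j) r k i L)) ⟩
    _ ∎
    where
    j : ℕ
    j = suc (i ℕ.+ L)
    mid : List Vector
    mid = interior x i L
    lower : ∀ k → σ R n (L ℕ.* N) (r -ℕ k) (x i ∷ mid)
                  ≡ σ R n (N ℕ.* (j ∸ i ∸ 1)) (r -ℕ k) (segment x i (i ℕ.+ L))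
    lower k = cong₂ (λ d vs → σ R n d (r -ℕ k) vs) (≡.sym (m*[1+n+o∸n∸1]≡o*m N i L)) (≡.sym (segment-∷ x i L))

  σ̄-segment-split : ∀ (x : ℕ → Vector) i L r → let j = suc (i ℕ.+ L) in
    σ̄ R n (N ℕ.* (j ∸ i)) r (segment x i j)
      ≈ ∑ N (λ k → falling (x i) k r * σ̄ R n (N ℕ.* (j ∸ i ∸ 1)) (r -ℕ k) (segment x (suc i) j)
                   * ∏ (n ∸ k ∸ 1) (λ s → x j ⟨ r -ℕ k ℤ.+ + j -ℕ i ℤ.- ℤ.1ℤ -ℕ s ⟩))
  σ̄-segment-split x i L r = begin
    σ̄ R n (N ℕ.* (j ∸ i)) r (segment x i j)
      ≡⟨ cong₂ (λ d vs → σ̄ R n d r vs) (m*[1+n+o∸n]≡m+o*m N i L) (segment-∷-∷ʳ x i L) ⟩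
    σ̄ R n (N ℕ.+ L ℕ.* N) r ((x i ∷ mid) ∷ʳ x j)
      ≈⟨ σ̄-top-split (x i) mid (x j) (length-interior x i L) r ⟩
    ∑ N (λ k → falling (x i) k r * σ̄ R n (L ℕ.* N) (r -ℕ k) (mid ∷ʳ x j)
               * falling (x j) (N ∸ k) (r -ℕ k -ℕ L ℕ.* N))
      ≈⟨ ∑-cong N (λ k _ → *-cong (*-congˡ (reflexive (lower k))) (falling-reindex (x j) r k i L)) ⟩
    _ ∎
    where
    j : ℕ
    j = suc (i ℕ.+ L)
    mid : List Vector
    mid = interior x i L
    lower : ∀ k → σ̄ R n (L ℕ.* N) (r -ℕ k) (mid ∷ʳ x j)
                  ≡ σ̄ R n (N ℕ.* (j ∸ i ∸ 1)) (r -ℕ k) (segment x (suc i) j)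
    lower k = cong₂ (λ d vs → σ̄ R n d (r -ℕ k) vs) (≡.sym (m*[1+n+o∸n∸1]≡o*m N i L))
                                                    (≡.sym (segment-∷ʳ x i L))

mainTheorem1 : ∀ {c ℓ} (R : CommutativeSemiring c ℓ) (n m : ℕ) .{{_ : NonZero n}}
    (x : ℕ → Fin n → CommutativeSemiring.Carrier R) (i j : ℕ) → 1 ≤ i → i < j → j ≤ m → (r : ℤ) →
    let open CommutativeSemiring R in
    (σ R n ((n ∸ 1) ℕ.* (j ∸ i)) r (segment x i j)
      ≈ sumTo R n (n ∸ 1) (λ k →
          prodBelow R n k (λ t → comp R n (x i) (r ℤ.- + t))
          * σ R n ((n ∸ 1) ℕ.* (j ∸ i ∸ 1)) (r ℤ.- + k) (segment x i (j ∸ 1))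
          * prodBelow R n (n ∸ k ∸ 1)
              (λ s → comp R n (x j) (r ℤ.- + k ℤ.+ + j ℤ.- + i ℤ.- ℤ.1ℤ ℤ.- + s))))
    ×
    (σ̄ R n ((n ∸ 1) ℕ.* (j ∸ i)) r (segment x i j)
      ≈ sumTo R n (n ∸ 1) (λ k →
          prodBelow R n k (λ t → comp R n (x i) (r ℤ.- + t))
          * σ̄ R n ((n ∸ 1) ℕ.* (j ∸ i ∸ 1)) (r ℤ.- + k) (segment x (ℕ.suc i) j)
          * prodBelow R n (n ∸ k ∸ 1)
              (λ s → comp R n (x j) (r ℤ.- + k ℤ.+ + j ℤ.- + i ℤ.- ℤ.1ℤ ℤ.- + s))))
-- The bounds 1 ≤ i and j ≤ m only keep the indices within x_1, …, x_m; the identity holds for every i < j.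
mainTheorem1 R (suc N) m x i j _ i<j _ r with ℕ.m≤n⇒∃[o]m+o≡n i<j
... | L , ≡.refl = σ-segment-split R N x i L r , σ̄-segment-split R N x i L r
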